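{- Let $\mathcal C\subset\mathbb{P}^{n-1}$ be a real polyhedral cone, let $\Gamma_1,\Gamma_2\subset\Sigma$ be finite sets, and let $\mathcal H\in\Sigma$ be such that the apex of $\mathcal H$ differs from the apex of every half-space in $\Gamma_2$. If $\tau(\{\mathcal H\}\cup\Gamma_1)=\tau(\Gamma_2)$, then $\mathcal H\in\tau(\Gamma_1)$.
   Context: Max-plus semiring $\mathbb{R}_{\max}=\mathbb{R}\cup\{ -\infty\}$ with $\oplus=\max$, $\otimes=+$; on $\mathbb{R}_{\max}^n$, componentwise maximum and $\lambda x=(\lambda+x_1,\dots,\lambda+x_n)$. A real polyhedral cone is $\mathcal C=\{\lambda_1v^1\oplus\dots\oplus\lambda_pv^p:\lambda_r\in\mathbb{R}_{\max}\}$ with $v^1,\dots,v^p\in\mathbb{R}^n$, identified with its image in $\mathbb{P}^{n-1}=\mathbb{R}^n/\mathbb{R}(1,\dots,1)$. For $a\in\mathbb{R}^n$ and non-empty proper $I\subsetneq[n]$, the tropical half-space $\mathcal H(a,I)=\{x\in\mathbb{R}_{\max}^n\setminus\{(-\infty,\dots,-\infty)\}:\max_{i\in I}(x_i-a_i)\ge\max_{j\notin I}(x_j-a_j)\}$ (modulo adding constants) has apex $a\in\mathbb{P}^{n-1}$ and sectors $I$, both uniquely determined. Let $\Sigma$ be the set of all half-spaces $\mathcal H(a,I)$ with $\mathcal C\subset\mathcal H(a,I)$ and $a\in\mathcal C$. For $\Gamma\subset\Sigma$ define $\tau(\Gamma)=\{\mathcal H\in\Sigma:\bigcap_{\mathcal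 H'\in\Gamma}\mathcal H'\subset\mathcal H\}$, with the convention $\tau(\emptyset)=\emptyset$. -}

module Defs where

open import Level using (0ℓ)
open import Data.Nat using (ℕ; zero; suc)
open import Data.Fin using (Fin; zero; suc)
open import Data.Fin.Subset using (Subset; _∈_; _∉_; Nonempty)
open import Data.Product using (Σ; ∃; ∃-syntax; _×_; _,_)
open import Data.Sum using (_⊎_; inj₁; inj₂)
open import Data.Empty using (⊥)
open import Data.List using (List; []; _∷_)
import Data.List.Membership.Propositional as LM
open import Relation.Nullary using (¬_)
open import Relation.Binary.PropositionalEquality using (_≡_)
open import Relation.Binary.Structures using (IsTotalOrder)
open import Algebra.Structures using (IsCommutativeRing)

-- The real numbers, axiomatised as a (Dedekind-)complete ordered field.
-- (agda-stdlib has no reals; every such structure is isomorphic to ℝ.)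

record Reals : Set₁ where
  infixl 6 _+_
  infixl 7 _*_
  infix 4 _≤_
  field
    ℝ     : Set
    _+_   : ℝ → ℝ → ℝ
    _*_   : ℝ → ℝ → ℝ
    -_    : ℝ → ℝ
    0ℝ 1ℝ : ℝ
    _≤_   : ℝ → ℝ → Set
    isCommutativeRing : IsCommutativeRing _≡_ _+_ _*_ -_ 0ℝ 1ℝ
    0≢1   : ¬ (0ℝ ≡ 1ℝ)
    inverse : ∀ x → ¬ (x ≡ 0ℝ) → ∃[ y ] (x * y ≡ 1ℝ)
    isTotalOrder : IsTotalOrder _≡_ _≤_
    +-mono-≤ : ∀ {x y} z → x ≤ y → x + z ≤ y + z
    *-nonneg : ∀ {x y} → 0ℝ ≤ x → 0ℝ ≤ y → 0ℝ ≤ x * y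
    complete : (S : ℝ → Set) → (∃[ x ] S x) → (∃[ b ] (∀ x → S x → x ≤ b)) →
               ∃[ s ] ((∀ x → S x → x ≤ s) × (∀ b → (∀ x → S x → x ≤ b) → s ≤ b))

module Trop (R : Reals) where
  open Reals R

  data ℝmax : Set where
    -∞  : ℝmax
    fin : ℝ → ℝmax

  infix 4 _≤ₘ_
  data _≤ₘ_ : ℝmax → ℝmax → Set where
    -∞≤ : ∀ {y} → -∞ ≤ₘ y
    fin≤ : ∀ {x y} → x ≤ y → fin x ≤ₘ fin y

  _⊕_ : ℝmax → ℝmax → ℝmax
  -∞ ⊕ y = y
  fin x ⊕ -∞ = fin x
  fin x ⊕ fin y with IsTotalOrder.total isTotalOrder x y
  ... | inj₁ _ = fin y
  ... | inj₂ _ = fin x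

  _⊗_ : ℝmax → ℝmax → ℝmax
  -∞ ⊗ y = -∞
  fin x ⊗ -∞ = -∞
  fin x ⊗ fin y = fin (x + y)

  _−ᵣ_ : ℝmax → ℝ → ℝmax
  x −ᵣ a = x ⊗ fin (- a)

  ⨁ : (p : ℕ) → (Fin p → ℝmax) → ℝmax
  ⨁ zero f = -∞
  ⨁ (suc p) f = f zero ⊕ ⨁ p (λ r → f (suc r))

  Vecₘ : ℕ → Set
  Vecₘ n = Fin n → ℝmax

  NonZero : ∀ {n} → Vecₘ n → Set
  NonZero {n} x = ∃[ i ] ¬ (x i ≡ -∞)

  embed : ∀ {n} → (Fin n → ℝ) → Vecₘ n
  embed a i = fin (a i)

  -- equality in ℙ^{n-1} = ℝ^n / ℝ(1,…,1)
  _≈ℙ_ : ∀ {n} → (Fin n → ℝ) → (Fin n → ℝ) → Set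
  a ≈ℙ b = ∃[ c ] (∀ i → a i ≡ b i + c)

  record Cone (n : ℕ) : Set where
    field
      p   : ℕ
      gen : Fin p → Fin n → ℝ

  _∈C_ : ∀ {n} → Vecₘ n → Cone n → Set
  x ∈C C = Σ (Fin p → ℝmax) λ λs → (∀ i → x i ≡ ⨁ p (λ r → λs r ⊗ fin (gen r i)))
    where open Cone C

  record HalfSpace (n : ℕ) : Set where
    field
      apex     : Fin n → ℝ
      sectors  : Subset n
      nonempty : Nonempty sectors
      proper   : ∃[ j ] (j ∉ sectors)
  open HalfSpace public

  -- x ∈ H(a,I) : max_{i∈I}(x_i - a_i) ≥ max_{j∉I}(x_j - a_j), x ≠ (-∞,…,-∞).
  -- (Since I is finite and non-empty, the max over I is attained.)
  _∈H_ : ∀ {n} → Vecₘ n → HalfSpace n → Set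
  x ∈H H = NonZero x ×
    ∃[ i ] (i ∈ sectors H ×
      (∀ j → j ∉ sectors H → (x j −ᵣ apex H j) ≤ₘ (x i −ᵣ apex H i)))

  -- C ⊂ H (as subsets of ℙ^{n-1}, i.e. for non-zero points of C)
  _⊆H_ : ∀ {n} → Cone n → HalfSpace n → Set
  C ⊆H H = ∀ x → NonZero x → x ∈C C → x ∈H H

  Σ𝓗 : ∀ {n} → Cone n → HalfSpace n → Set
  Σ𝓗 C H = (C ⊆H H) × (embed (apex H) ∈C C)

  -- finite subsets of Σ are given by lists of half-spaces in Σ
  _∈L_ : ∀ {n} → HalfSpace n → List (HalfSpace n) → Set
  H ∈L Γ = LM._∈_ H Γ

  InΣ : ∀ {n} → Cone n → List (HalfSpace n) → Set
  InΣ C Γ = ∀ G → G ∈L Γ → Σ𝓗 C G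

  τ : ∀ {n} → Cone n → List (HalfSpace n) → HalfSpace n → Set
  τ C [] H = ⊥
  τ C Γ@(_ ∷ _) H = Σ𝓗 C H × (∀ x → (∀ G → G ∈L Γ → x ∈H G) → x ∈H H)

module Submission where

-- Let x ∈ ⋂Γ₁, and let ρ be the largest value of x − a (a the apex of H), attained at m.
-- Raise x to y = x ⊕ (a + ρ − ε), where 0 < ε is below the spread max(b − a) − min(b − a)
-- of every apex b of Γ₂; the spreads are positive since these apexes differ from a in ℙⁿ⁻¹.
-- Then y ∈ ⋂Γ₁, and y lies in every G = H(b, K) of Γ₂: the point w = y ⊕ (b + s) with
-- s = ρ − max(b − a) lies in H and in ⋂Γ₁, hence in G ∈ τ(H ∪ Γ₁). If the y-part of w wins at
-- the sector witnessing w ∈ G, the same sector witnesses y ∈ G; otherwise y_j − b_j ≤ s for all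
-- j ∉ K, and the coordinate minimising b − a, where y_k − b_k ≥ ρ − ε − min(b − a) > s, lies in
-- K and witnesses y ∈ G. Hence y ∈ ⋂Γ₂ ⊆ H, as H ∈ τ(Γ₂). A sector i of H with
-- y_i − a_i ≥ y_m − a_m ≥ ρ > ρ − ε must have y_i = x_i, and then i witnesses x ∈ H.

open import Defs
open import Level using (0ℓ)
open import Function using (_∘_; case_of_)
open import Data.Nat using (ℕ)
open import Data.Fin using (Fin)
open import Data.Fin.Subset using (Subset; _∈_; _∉_)
open import Data.Fin.Subset.Properties using (_∈?_)
open import Data.List using (List; []; _∷_; allFin)
open import Data.List.Membership.Propositional using () renaming (_∈_ to _∈ˡ_)
open import Data.List.Membership.Propositional.Properties using (∈-allFin)
import Data.List.Relation.Unary.All as All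
open import Data.List.Relation.Unary.Any using (here; there)
import Data.List.Extrema
open import Data.Product using (∃-syntax; _×_; _,_; proj₁; proj₂)
open import Data.Sum using (_⊎_; inj₁; inj₂)
open import Data.Empty using (⊥-elim)
open import Relation.Nullary using (¬_; yes; no)
open import Relation.Binary.Bundles using (TotalOrder; Poset)
open import Relation.Binary.Structures using (IsTotalOrder)
open import Relation.Binary.PropositionalEquality
open import Algebra.Bundles using (CommutativeRing)
import Relation.Binary.Construct.NonStrictToStrict as NonStrictToStrict
import Relation.Binary.Reasoning.PartialOrder as PartialOrderReasoning

module FinExtrema {c ℓ₁ ℓ₂} (O : TotalOrder c ℓ₁ ℓ₂) where
  open TotalOrder O
  open Data.List.Extrema O using (argmax; argmin; f[xs]≤f[argmax]; f[argmin]≤f[xs])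

  argmax-Fin : ∀ {n} (f : Fin n → Carrier) → Fin n → ∃[ j ] (∀ k → f k ≤ f j)
  argmax-Fin f k₀ =
    argmax f k₀ (allFin _) , λ k → All.lookup (f[xs]≤f[argmax] {f = f} k₀ (allFin _)) (∈-allFin k)

  argmin-Fin : ∀ {n} (f : Fin n → Carrier) → Fin n → ∃[ j ] (∀ k → f j ≤ f k)
  argmin-Fin f k₀ =
    argmin f k₀ (allFin _) , λ k → All.lookup (f[argmin]≤f[xs] {f = f} k₀ (allFin _)) (∈-allFin k)

module OrderedField (R : Reals) where
  open Reals R

  commutativeRing : CommutativeRing 0ℓ 0ℓ
  commutativeRing = record { isCommutativeRing = isCommutativeRing }

  open CommutativeRing commutativeRing
    using (+-comm; +-assoc; +-identityʳ; -‿inverseʳ; *-identityˡ; distribʳ)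
  open import Algebra.Properties.AbelianGroup (CommutativeRing.+-abelianGroup commutativeRing)
    using (xyx⁻¹≈y; ⁻¹-anti-homo‿-; ⁻¹-∙-comm; ⁻¹-involutive; ⁻¹-injective; ε⁻¹≈ε;
           inverseʳ-unique; //-rightDividesˡ; //-rightDividesʳ; \\-leftDividesˡ)
  open import Algebra.Properties.CommutativeSemigroup
    (CommutativeRing.+-commutativeSemigroup commutativeRing) using (xy∙z≈xz∙y)
  open import Algebra.Properties.Ring (CommutativeRing.ring commutativeRing) using (-1*x≈-x)
  open IsTotalOrder isTotalOrder public
    using (total; antisym) renaming (refl to ≤-refl; trans to ≤-trans)
  open NonStrictToStrict _≡_ _≤_ public using (_<_; <⇒≤; <⇒≉; ≤∧≉⇒<)

  ≤-totalOrder : TotalOrder 0ℓ 0ℓ 0ℓ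
  ≤-totalOrder = record { isTotalOrder = isTotalOrder }

  ≤-poset : Poset 0ℓ 0ℓ 0ℓ
  ≤-poset = TotalOrder.poset ≤-totalOrder

  <⇒≱ : ∀ {x y} → x < y → ¬ (y ≤ x)
  <⇒≱ = NonStrictToStrict.<⇒≱ _≡_ _≤_ antisym

  <-≤-trans : ∀ {x y z} → x < y → y ≤ z → x < z
  <-≤-trans = NonStrictToStrict.<-≤-trans _≡_ _≤_ sym ≤-trans antisym (subst (_ ≤_))

  [x+y]-x≡y : ∀ x y → (x + y) + - x ≡ y
  [x+y]-x≡y = xyx⁻¹≈y

  [x+s]-y≡[x-y]+s : ∀ x y s → (x + s) + - y ≡ (x + - y) + s
  [x+s]-y≡[x-y]+s x y s = xy∙z≈xz∙y x s (- y)

  x+[y-x]≡y : ∀ x y → x + (y + - x) ≡ y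
  x+[y-x]≡y x y = trans (+-comm x _) (//-rightDividesˡ x y)

  [x+t]-y≡t-[y-x] : ∀ x y t → (x + t) + - y ≡ t + - (y + - x)
  [x+t]-y≡t-[y-x] x y t = begin
    (x + t) + - y   ≡⟨ [x+s]-y≡[x-y]+s x y t ⟩
    (x + - y) + t   ≡⟨ +-comm _ t ⟩
    t + (x + - y)   ≡⟨ cong (t +_) (⁻¹-anti-homo‿- y x) ⟨
    t + - (y + - x) ∎
    where open ≡-Reasoning

  [x-y]-z≡x-[y+z] : ∀ x y z → (x + - y) + - z ≡ x + - (y + z)
  [x-y]-z≡x-[y+z] x y z = trans (+-assoc x (- y) (- z)) (cong (x +_) (⁻¹-∙-comm y z))

  -≡⇒≡- : ∀ {a b d} → b + - a ≡ d → a ≡ b + - d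
  -≡⇒≡- {a} {b} {d} b-a≡d = sym (begin
    b + - d        ≡⟨ cong (_+ - d) (trans (cong (_+ a) (sym b-a≡d)) (//-rightDividesˡ a b)) ⟨
    (d + a) + - d  ≡⟨ [x+y]-x≡y d a ⟩
    a              ∎)
    where open ≡-Reasoning

  +-monoʳ-≤ : ∀ z {x y} → x ≤ y → z + x ≤ z + y
  +-monoʳ-≤ z {x} {y} x≤y = subst₂ _≤_ (+-comm x z) (+-comm y z) (+-mono-≤ z x≤y)

  +-cancelʳ-≡ : ∀ z {x y} → x + z ≡ y + z → x ≡ y
  +-cancelʳ-≡ z {x} {y} eq =
    trans (sym (//-rightDividesʳ z x)) (trans (cong (_+ - z) eq) (//-rightDividesʳ z y))

  +-monoˡ-< : ∀ z {x y} → x < y → x + z < y + z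
  +-monoˡ-< z (x≤y , x≢y) = +-mono-≤ z x≤y , x≢y ∘ +-cancelʳ-≡ z

  +-monoʳ-< : ∀ z {x y} → x < y → z + x < z + y
  +-monoʳ-< z {x} {y} x<y = subst₂ _<_ (+-comm x z) (+-comm y z) (+-monoˡ-< z x<y)

  neg-antitone-≤ : ∀ {x y} → x ≤ y → - y ≤ - x
  neg-antitone-≤ {x} {y} x≤y = subst₂ _≤_ (\\-leftDividesˡ x (- y))
    (trans (cong (y +_) (+-comm (- x) (- y))) (\\-leftDividesˡ y (- x)))
    (+-mono-≤ (- x + - y) x≤y)

  neg-antitone-< : ∀ {x y} → x < y → - y < - x
  neg-antitone-< (x≤y , x≢y) = neg-antitone-≤ x≤y , λ -y≡-x → x≢y (sym (⁻¹-injective -y≡-x))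

  -‿antitoneʳ-< : ∀ c {x y} → x < y → c + - y < c + - x
  -‿antitoneʳ-< c x<y = +-monoʳ-< c (neg-antitone-< x<y)

  x-ε<x : ∀ x {ε} → 0ℝ < ε → x + - ε < x
  x-ε<x x {ε} 0<ε =
    subst (x + - ε <_) (trans (cong (x +_) ε⁻¹≈ε) (+-identityʳ x)) (-‿antitoneʳ-< x 0<ε)

  <-⇒+< : ∀ {x y e} → e < y + - x → e + x < y
  <-⇒+< {x} {y} e<y-x = subst (_ <_) (//-rightDividesˡ x y) (+-monoˡ-< x e<y-x)

  <⇒0<- : ∀ {x y} → x < y → 0ℝ < y + - x
  <⇒0<- {x} x<y = subst (_< _) (-‿inverseʳ x) (+-monoˡ-< (- x) x<y)

  0<1 : 0ℝ < 1ℝ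
  0<1 = 0≤1 , 0≢1
    where
    0≤1 : 0ℝ ≤ 1ℝ
    0≤1 with total 0ℝ 1ℝ
    ... | inj₁ 0≤1 = 0≤1
    ... | inj₂ 1≤0 = subst (0ℝ ≤_) (trans (-1*x≈-x (- 1ℝ)) (⁻¹-involutive 1ℝ)) (*-nonneg 0≤-1 0≤-1)
      where
      0≤-1 : 0ℝ ≤ - 1ℝ
      0≤-1 = subst (_≤ - 1ℝ) ε⁻¹≈ε (neg-antitone-≤ 1≤0)

  1+1≢0 : ¬ (1ℝ + 1ℝ ≡ 0ℝ)
  1+1≢0 1+1≡0 = <⇒≱ 0<1
    (subst₂ _≤_ (sym (inverseʳ-unique 1ℝ 1ℝ 1+1≡0)) ε⁻¹≈ε (neg-antitone-≤ (<⇒≤ 0<1)))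

  halve : ∀ γ → ∃[ ε ] (ε + ε ≡ γ)
  halve γ with inverse (1ℝ + 1ℝ) 1+1≢0
  ... | h , [1+1]h≡1 = h * γ , (begin
    h * γ + h * γ  ≡⟨ distribʳ γ h h ⟨
    (h + h) * γ    ≡⟨ cong (_* γ) h+h≡1 ⟩
    1ℝ * γ         ≡⟨ *-identityˡ γ ⟩
    γ              ∎)
    where
    open ≡-Reasoning
    h+h≡1 : h + h ≡ 1ℝ
    h+h≡1 = trans (sym (cong₂ _+_ (*-identityˡ h) (*-identityˡ h)))
                  (trans (sym (distribʳ h 1ℝ 1ℝ)) [1+1]h≡1)

  dense-below : ∀ {γ} → 0ℝ < γ → ∃[ ε ] (0ℝ < ε × ε < γ)
  dense-below {γ} 0<γ with halve γ
  ... | ε , ε+ε≡γ = ε , 0<ε , subst₂ _<_ (+-identityʳ ε) ε+ε≡γ (+-monoʳ-< ε 0<ε)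
    where
    0<ε : 0ℝ < ε
    0<ε with total 0ℝ ε
    ... | inj₁ 0≤ε = 0≤ε , λ 0≡ε →
      <⇒≉ 0<γ (trans (sym (+-identityʳ 0ℝ)) (trans (cong₂ _+_ 0≡ε 0≡ε) ε+ε≡γ))
    ... | inj₂ ε≤0 = ⊥-elim (<⇒≱ 0<γ (subst₂ _≤_ ε+ε≡γ (+-identityʳ 0ℝ)
      (≤-trans (+-mono-≤ ε ε≤0) (+-monoʳ-≤ 0ℝ ε≤0))))

  ∃-positive-lower-bound : ∀ {A : Set} (xs : List A) (g : A → ℝ) → (∀ x → x ∈ˡ xs → 0ℝ < g x) →
                           ∃[ δ ] (0ℝ < δ × ∀ x → x ∈ˡ xs → δ ≤ g x)
  ∃-positive-lower-bound [] g _ = 1ℝ , 0<1 , λ _ ()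
  ∃-positive-lower-bound (x ∷ xs) g 0<g with ∃-positive-lower-bound xs g (λ y y∈ → 0<g y (there y∈))
  ... | δ , 0<δ , δ≤g with total (g x) δ
  ...   | inj₁ gx≤δ = g x , 0<g x (here refl) , λ where
    _ (here refl) → ≤-refl
    y (there y∈)  → ≤-trans gx≤δ (δ≤g y y∈)
  ...   | inj₂ δ≤gx = δ , 0<δ , λ where
    _ (here refl) → δ≤gx
    y (there y∈)  → δ≤g y y∈

  ∃-positive-below : ∀ {A : Set} (xs : List A) (g : A → ℝ) → (∀ x → x ∈ˡ xs → 0ℝ < g x) →
                     ∃[ ε ] (0ℝ < ε × ∀ x → x ∈ˡ xs → ε < g x)
  ∃-positive-below xs g 0<g with ∃-positive-lower-bound xs g 0<g
  ... | δ , 0<δ , δ≤g with dense-below 0<δ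
  ...   | ε , 0<ε , ε<δ = ε , 0<ε , λ x x∈ → <-≤-trans ε<δ (δ≤g x x∈)

module MaxPlus (R : Reals) where
  open Reals R
  open Trop R
  open OrderedField R

  ≤ₘ-refl : ∀ {x} → x ≤ₘ x
  ≤ₘ-refl { -∞}   = -∞≤
  ≤ₘ-refl {fin x} = fin≤ ≤-refl

  ≤ₘ-trans : ∀ {x y z} → x ≤ₘ y → y ≤ₘ z → x ≤ₘ z
  ≤ₘ-trans -∞≤       _         = -∞≤
  ≤ₘ-trans (fin≤ p) (fin≤ q) = fin≤ (≤-trans p q)

  ≤ₘ-antisym : ∀ {x y} → x ≤ₘ y → y ≤ₘ x → x ≡ y
  ≤ₘ-antisym -∞≤       -∞≤       = refl
  ≤ₘ-antisym (fin≤ p) (fin≤ q) = cong fin (antisym p q)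

  ≤ₘ-total : ∀ x y → x ≤ₘ y ⊎ y ≤ₘ x
  ≤ₘ-total -∞      _       = inj₁ -∞≤
  ≤ₘ-total (fin x) -∞      = inj₂ -∞≤
  ≤ₘ-total (fin x) (fin y) with total x y
  ... | inj₁ x≤y = inj₁ (fin≤ x≤y)
  ... | inj₂ y≤x = inj₂ (fin≤ y≤x)

  ≤ₘ-totalOrder : TotalOrder 0ℓ 0ℓ 0ℓ
  ≤ₘ-totalOrder = record
    { isTotalOrder = record
      { isPartialOrder = record
        { isPreorder = record
          { isEquivalence = isEquivalence
          ; reflexive     = λ { refl → ≤ₘ-refl }
          ; trans         = ≤ₘ-trans
          }
        ; antisym = ≤ₘ-antisym
        }
      ; total = ≤ₘ-total
      }
    }

  fin≤⁻ : ∀ {x y} → fin x ≤ₘ fin y → x ≤ y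
  fin≤⁻ (fin≤ x≤y) = x≤y

  fin≤ₘ⇒≢-∞ : ∀ {r p} → fin r ≤ₘ p → ¬ (p ≡ -∞)
  fin≤ₘ⇒≢-∞ (fin≤ _) ()

  -∞-or-fin : ∀ p → p ≡ -∞ ⊎ ∃[ r ] (p ≡ fin r)
  -∞-or-fin -∞      = inj₁ refl
  -∞-or-fin (fin r) = inj₂ (r , refl)

  ≤ₘ-∞⇒≡-∞ : ∀ {p} → p ≤ₘ -∞ → p ≡ -∞
  ≤ₘ-∞⇒≡-∞ -∞≤ = refl

  ⊕-sel : ∀ x y → (x ⊕ y ≡ x) ⊎ (x ⊕ y ≡ y)
  ⊕-sel -∞      _       = inj₂ refl
  ⊕-sel (fin x) -∞      = inj₁ refl
  ⊕-sel (fin x) (fin y) with total x y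
  ... | inj₁ _ = inj₂ refl
  ... | inj₂ _ = inj₁ refl

  x≤ₘx⊕y : ∀ x y → x ≤ₘ x ⊕ y
  x≤ₘx⊕y -∞      _       = -∞≤
  x≤ₘx⊕y (fin x) -∞      = ≤ₘ-refl
  x≤ₘx⊕y (fin x) (fin y) with total x y
  ... | inj₁ x≤y = fin≤ x≤y
  ... | inj₂ _   = ≤ₘ-refl

  y≤ₘx⊕y : ∀ x y → y ≤ₘ x ⊕ y
  y≤ₘx⊕y -∞      _       = ≤ₘ-refl
  y≤ₘx⊕y (fin x) -∞      = -∞≤
  y≤ₘx⊕y (fin x) (fin y) with total x y
  ... | inj₁ _   = ≤ₘ-refl
  ... | inj₂ y≤x = fin≤ y≤x

  −ᵣ-monoˡ-≤ₘ : ∀ c {p q} → p ≤ₘ q → p −ᵣ c ≤ₘ q −ᵣ c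
  −ᵣ-monoˡ-≤ₘ c -∞≤       = -∞≤
  −ᵣ-monoˡ-≤ₘ c (fin≤ p≤q) = fin≤ (+-mono-≤ (- c) p≤q)

  −ᵣ≤ₘ-∞⇒≡-∞ : ∀ {p c} → p −ᵣ c ≤ₘ -∞ → p ≡ -∞
  −ᵣ≤ₘ-∞⇒≡-∞ { -∞} _ = refl

  ⊕-−ᵣ-lub : ∀ {p q c r} → p −ᵣ c ≤ₘ r → q −ᵣ c ≤ₘ r → (p ⊕ q) −ᵣ c ≤ₘ r
  ⊕-−ᵣ-lub {p} {q} {c} {r} p-c≤r q-c≤r with ⊕-sel p q
  ... | inj₁ p⊕q≡p = subst (λ v → v −ᵣ c ≤ₘ r) (sym p⊕q≡p) p-c≤r
  ... | inj₂ p⊕q≡q = subst (λ v → v −ᵣ c ≤ₘ r) (sym p⊕q≡q) q-c≤r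

module HalfSpaces (R : Reals) where
  open Reals R
  open Trop R
  open OrderedField R
  open MaxPlus R

  infix 4 _∈⋂_
  _∈⋂_ : ∀ {n} → Vecₘ n → List (HalfSpace n) → Set
  x ∈⋂ Γ = ∀ G → G ∈L Γ → x ∈H G

  infixr 6 _⊕ᵥ_
  _⊕ᵥ_ : ∀ {n} → Vecₘ n → Vecₘ n → Vecₘ n
  (x ⊕ᵥ y) k = x k ⊕ y k

  ∈H-intro : ∀ {n} {x : Vecₘ n} (G : HalfSpace n) {i} → NonZero x → i ∈ sectors G →
             (∀ k → x k −ᵣ apex G k ≤ₘ x i −ᵣ apex G i) → x ∈H G
  ∈H-intro G x≢0 i∈ x≤xi = x≢0 , _ , i∈ , λ j _ → x≤xi j

  ∈H-dominated : ∀ {n} {x : Vecₘ n} (G : HalfSpace n) → x ∈H G →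
                 ∀ k → ∃[ i ] (i ∈ sectors G × x k −ᵣ apex G k ≤ₘ x i −ᵣ apex G i)
  ∈H-dominated G (_ , i , i∈ , x≤xi) k with k ∈? sectors G
  ... | yes k∈ = k , k∈ , ≤ₘ-refl
  ... | no k∉  = i , i∈ , x≤xi k k∉

  ∈H-⊕ᵥ : ∀ {n} {x y : Vecₘ n} (G : HalfSpace n) → x ∈H G → y ∈H G → (x ⊕ᵥ y) ∈H G
  ∈H-⊕ᵥ {n} {x} {y} G ((k , xk≢-∞) , i , i∈ , x≤xi) (_ , i′ , i′∈ , y≤yi′) =
    (k , λ eq → xk≢-∞ (≤ₘ-∞⇒≡-∞ (subst (x k ≤ₘ_) eq (x≤ₘx⊕y (x k) (y k))))) ,
    witness (≤ₘ-total (x i −ᵣ b i) (y i′ −ᵣ b i′))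
    where
    b : Fin n → ℝ
    b = apex G
    x≤x⊕y : ∀ k → x k −ᵣ b k ≤ₘ (x ⊕ᵥ y) k −ᵣ b k
    x≤x⊕y k = −ᵣ-monoˡ-≤ₘ (b k) (x≤ₘx⊕y (x k) (y k))
    y≤x⊕y : ∀ k → y k −ᵣ b k ≤ₘ (x ⊕ᵥ y) k −ᵣ b k
    y≤x⊕y k = −ᵣ-monoˡ-≤ₘ (b k) (y≤ₘx⊕y (x k) (y k))
    witness : x i −ᵣ b i ≤ₘ y i′ −ᵣ b i′ ⊎ y i′ −ᵣ b i′ ≤ₘ x i −ᵣ b i →
              ∃[ c ] (c ∈ sectors G ×
                      (∀ j → j ∉ sectors G → (x ⊕ᵥ y) j −ᵣ b j ≤ₘ (x ⊕ᵥ y) c −ᵣ b c))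
    witness (inj₁ xi≤yi′) = i′ , i′∈ , λ j j∉ → ⊕-−ᵣ-lub
      (≤ₘ-trans (x≤xi j j∉) (≤ₘ-trans xi≤yi′ (y≤x⊕y i′))) (≤ₘ-trans (y≤yi′ j j∉) (y≤x⊕y i′))
    witness (inj₂ yi′≤xi) = i , i∈ , λ j j∉ → ⊕-−ᵣ-lub
      (≤ₘ-trans (x≤xi j j∉) (x≤x⊕y i)) (≤ₘ-trans (y≤yi′ j j∉) (≤ₘ-trans yi′≤xi (x≤x⊕y i)))

  ∈H-translate : ∀ {n} {c : Fin n → ℝ} (G : HalfSpace n) s →
                 embed c ∈H G → embed (λ k → c k + s) ∈H G
  ∈H-translate {c = c} G s ((k , _) , i , i∈ , c≤ci) =
    (k , λ ()) , i , i∈ , λ j j∉ → fin≤ (subst₂ _≤_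
      (sym ([x+s]-y≡[x-y]+s (c j) (apex G j) s)) (sym ([x+s]-y≡[x-y]+s (c i) (apex G i) s))
      (+-mono-≤ s (fin≤⁻ (c≤ci j j∉))))

  constant-difference⇒≈ℙ : ∀ {n} {a b : Fin n → ℝ} {d} → (∀ k → b k + - a k ≡ d) → a ≈ℙ b
  constant-difference⇒≈ℙ {d = d} b-a≡d = - d , λ k → -≡⇒≡- (b-a≡d k)

  indicatorᶜ : ∀ {n} → Subset n → Vecₘ n
  indicatorᶜ I k with k ∈? I
  ... | yes _ = -∞
  ... | no _  = fin 0ℝ

  indicatorᶜ-∈ : ∀ {n} {I : Subset n} {k} → k ∈ I → indicatorᶜ I k ≡ -∞
  indicatorᶜ-∈ {I = I} {k} k∈ with k ∈? I
  ... | yes _  = refl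
  ... | no k∉ = ⊥-elim (k∉ k∈)

  indicatorᶜ-∉ : ∀ {n} {I : Subset n} {k} → k ∉ I → indicatorᶜ I k ≡ fin 0ℝ
  indicatorᶜ-∉ {I = I} {k} k∉ with k ∈? I
  ... | yes k∈ = ⊥-elim (k∉ k∈)
  ... | no _   = refl

  indicatorᶜ-NonZero : ∀ {n} (H : HalfSpace n) → NonZero (indicatorᶜ (sectors H))
  indicatorᶜ-NonZero H with proper H
  ... | j , j∉ = j , λ eq → case trans (sym (indicatorᶜ-∉ j∉)) eq of λ ()

  indicatorᶜ∉H : ∀ {n} (H : HalfSpace n) → ¬ (indicatorᶜ (sectors H) ∈H H)
  indicatorᶜ∉H H (_ , i , i∈ , ind≤indᵢ) with proper H
  ... | j , j∉ = fin≤ₘ⇒≢-∞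
    (subst (λ v → v −ᵣ apex H j ≤ₘ _) (indicatorᶜ-∉ j∉) (ind≤indᵢ j j∉))
    (cong (_−ᵣ apex H i) (indicatorᶜ-∈ i∈))

  apex∈H : ∀ {n} (C : Cone n) (G G′ : HalfSpace n) → Σ𝓗 C G → Σ𝓗 C G′ → embed (apex G) ∈H G′
  apex∈H C G G′ (_ , apex∈C) (C⊆G′ , _) = C⊆G′ _ (proj₁ (nonempty G) , λ ()) apex∈C

  apex∈⋂ : ∀ {n} (C : Cone n) (G : HalfSpace n) Γ → Σ𝓗 C G → InΣ C Γ → embed (apex G) ∈⋂ Γ
  apex∈⋂ C G Γ G∈Σ Γ⊆Σ G′ G′∈ = apex∈H C G G′ G∈Σ (Γ⊆Σ G′ G′∈)

  τ-elim : ∀ {n} (C : Cone n) Γ G → τ C Γ G → ∀ x → x ∈⋂ Γ → x ∈H G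
  τ-elim C (_ ∷ _) G (_ , ⋂⊆G) = ⋂⊆G

  τ-refl : ∀ {n} (C : Cone n) Γ G → G ∈L Γ → Σ𝓗 C G → τ C Γ G
  τ-refl C (_ ∷ _) G G∈ G∈Σ = G∈Σ , λ x x∈⋂ → x∈⋂ G G∈

  -- For Γ = [] (τ(∅) = ∅) the hypothesis is absurd: no half-space contains every point.
  τ-intro : ∀ {n} (C : Cone n) Γ H → Σ𝓗 C H → (∀ x → NonZero x → x ∈⋂ Γ → x ∈H H) → τ C Γ H
  τ-intro C []      H _   ⋂⊆H = indicatorᶜ∉H H (⋂⊆H _ (indicatorᶜ-NonZero H) (λ _ ()))
  τ-intro C (G ∷ Γ) H H∈Σ ⋂⊆H = H∈Σ , λ x x∈⋂ → ⋂⊆H x (proj₁ (x∈⋂ G (here refl))) x∈⋂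

module Redundancy (R : Reals) where
  open Reals R
  open Trop R
  open OrderedField R
  open MaxPlus R
  open HalfSpaces R
  open FinExtrema

  module _ {n : ℕ} (Γ₁ Γ₂ : List (HalfSpace n)) (H : HalfSpace n)
    (apex-H∈⋂Γ₁  : embed (apex H) ∈⋂ Γ₁)
    (apex-Γ₂∈H   : ∀ G → G ∈L Γ₂ → embed (apex G) ∈H H)
    (apex-Γ₂∈⋂Γ₁ : ∀ G → G ∈L Γ₂ → embed (apex G) ∈⋂ Γ₁)
    (apexes-distinct : ∀ G → G ∈L Γ₂ → ¬ (apex H ≈ℙ apex G))
    (⋂[H∷Γ₁]⊆Γ₂ : ∀ G → G ∈L Γ₂ → ∀ x → x ∈⋂ (H ∷ Γ₁) → x ∈H G)
    (⋂Γ₂⊆H : ∀ x → x ∈⋂ Γ₂ → x ∈H H)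
    where

    a : Fin n → ℝ
    a = apex H

    k₀ : Fin n
    k₀ = proj₁ (nonempty H)

    δ : HalfSpace n → Fin n → ℝ
    δ G k = apex G k + - a k

    top bot : HalfSpace n → Fin n
    top G = proj₁ (argmax-Fin ≤-totalOrder (δ G) k₀)
    bot G = proj₁ (argmin-Fin ≤-totalOrder (δ G) k₀)

    δ≤δ-top : ∀ G k → δ G k ≤ δ G (top G)
    δ≤δ-top G = proj₂ (argmax-Fin ≤-totalOrder (δ G) k₀)

    δ-bot≤δ : ∀ G k → δ G (bot G) ≤ δ G k
    δ-bot≤δ G = proj₂ (argmin-Fin ≤-totalOrder (δ G) k₀)

    spread : HalfSpace n → ℝ
    spread G = δ G (top G) + - δ G (bot G)

    0<spread : ∀ G → G ∈L Γ₂ → 0ℝ < spread G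
    0<spread G G∈ = <⇒0<- (≤∧≉⇒< (δ-bot≤δ G (top G)) λ bot≡top →
      apexes-distinct G G∈ (constant-difference⇒≈ℙ λ k →
        antisym (δ≤δ-top G k) (subst (_≤ δ G k) bot≡top (δ-bot≤δ G k))))

    module Margin (ε : ℝ) (0<ε : 0ℝ < ε) (ε<spread : ∀ G → G ∈L Γ₂ → ε < spread G) where

      module Lift (x : Vecₘ n) (x∈⋂Γ₁ : x ∈⋂ Γ₁) (ρ : ℝ) (m : Fin n)
                  (x-a≤ρ : ∀ k → x k −ᵣ a k ≤ₘ fin ρ) (ρ≤xm-am : fin ρ ≤ₘ x m −ᵣ a m) where

        t : ℝ
        t = ρ + - ε

        y : Vecₘ n
        y = x ⊕ᵥ embed (λ k → a k + t)

        a+t≤y : ∀ k → fin (a k + t) ≤ₘ y k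
        a+t≤y k = y≤ₘx⊕y (x k) (fin (a k + t))

        y-NonZero : NonZero y
        y-NonZero = m , fin≤ₘ⇒≢-∞ (a+t≤y m)

        y-a≤ρ : ∀ k → y k −ᵣ a k ≤ₘ fin ρ
        y-a≤ρ k = ⊕-−ᵣ-lub (x-a≤ρ k)
          (fin≤ (subst (_≤ ρ) (sym ([x+y]-x≡y (a k) t)) (<⇒≤ (x-ε<x ρ 0<ε))))

        ρ≤ym-am : fin ρ ≤ₘ y m −ᵣ a m
        ρ≤ym-am = ≤ₘ-trans ρ≤xm-am (−ᵣ-monoˡ-≤ₘ (a m) (x≤ₘx⊕y (x m) _))

        y∈⋂Γ₁ : y ∈⋂ Γ₁
        y∈⋂Γ₁ G G∈ = ∈H-⊕ᵥ G (x∈⋂Γ₁ G G∈) (∈H-translate G t (apex-H∈⋂Γ₁ G G∈))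

        module _ (G : HalfSpace n) (G∈Γ₂ : G ∈L Γ₂) where

          b : Fin n → ℝ
          b = apex G

          s : ℝ
          s = ρ + - δ G (top G)

          z : Vecₘ n
          z = embed (λ k → b k + s)

          w : Vecₘ n
          w = y ⊕ᵥ z

          z-a≤ρ : ∀ k → z k −ᵣ a k ≤ₘ fin ρ
          z-a≤ρ k = fin≤ (begin
            (b k + s) + - a k  ≡⟨ [x+s]-y≡[x-y]+s (b k) (a k) s ⟩
            δ G k + s          ≤⟨ +-mono-≤ s (δ≤δ-top G k) ⟩
            δ G (top G) + s    ≡⟨ x+[y-x]≡y _ ρ ⟩
            ρ                  ∎)
            where open PartialOrderReasoning ≤-poset

          w∈H : w ∈H H
          w∈H with ∈H-dominated H (apex-Γ₂∈H G G∈Γ₂) (top G)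
          ... | i₀ , i₀∈I , top≤i₀ = ∈H-intro H (i₀ , fin≤ₘ⇒≢-∞ (z≤w i₀)) i₀∈I λ k →
                ≤ₘ-trans (⊕-−ᵣ-lub (y-a≤ρ k) (z-a≤ρ k))
                         (≤ₘ-trans ρ≤zi₀ (−ᵣ-monoˡ-≤ₘ (a i₀) (z≤w i₀)))
            where
            z≤w : ∀ k → z k ≤ₘ w k
            z≤w k = y≤ₘx⊕y (y k) (z k)
            ρ≤zi₀ : fin ρ ≤ₘ z i₀ −ᵣ a i₀
            ρ≤zi₀ = fin≤ (begin
              ρ                      ≡⟨ x+[y-x]≡y _ ρ ⟨
              δ G (top G) + s        ≤⟨ +-mono-≤ s (fin≤⁻ top≤i₀) ⟩
              δ G i₀ + s             ≡⟨ [x+s]-y≡[x-y]+s (b i₀) (a i₀) s ⟨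
              (b i₀ + s) + - a i₀    ∎)
              where open PartialOrderReasoning ≤-poset

          w∈G : w ∈H G
          w∈G = ⋂[H∷Γ₁]⊆Γ₂ G G∈Γ₂ w λ where
            _  (here refl)  → w∈H
            G′ (there G′∈) → ∈H-⊕ᵥ G′ (y∈⋂Γ₁ G′ G′∈) (∈H-translate G′ s (apex-Γ₂∈⋂Γ₁ G G∈Γ₂ G′ G′∈))

          s<t-δbot : s < t + - δ G (bot G)
          s<t-δbot = subst (s <_) (sym ([x-y]-z≡x-[y+z] ρ ε _))
            (-‿antitoneʳ-< ρ (<-⇒+< (ε<spread G G∈Γ₂)))

          t-δbot≤y-b : fin (t + - δ G (bot G)) ≤ₘ y (bot G) −ᵣ b (bot G)
          t-δbot≤y-b = subst (λ v → fin v ≤ₘ y (bot G) −ᵣ b (bot G))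
            ([x+t]-y≡t-[y-x] (a (bot G)) (b (bot G)) t)
            (−ᵣ-monoˡ-≤ₘ (b (bot G)) (a+t≤y (bot G)))

          ≤s⇒y∈G : (∀ j → j ∉ sectors G → y j −ᵣ b j ≤ₘ fin s) → y ∈H G
          ≤s⇒y∈G y-b≤s = y-NonZero , bot G , bot∈K , λ j j∉ →
            ≤ₘ-trans (y-b≤s j j∉) (≤ₘ-trans (fin≤ (<⇒≤ s<t-δbot)) t-δbot≤y-b)
            where
            bot∈K : bot G ∈ sectors G
            bot∈K with bot G ∈? sectors G
            ... | yes bot∈ = bot∈
            ... | no bot∉ = ⊥-elim (<⇒≱ s<t-δbot (fin≤⁻ (≤ₘ-trans t-δbot≤y-b (y-b≤s (bot G) bot∉))))

          y-b≤w-b : ∀ j → y j −ᵣ b j ≤ₘ w j −ᵣ b j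
          y-b≤w-b j = −ᵣ-monoˡ-≤ₘ (b j) (x≤ₘx⊕y (y j) (z j))

          y∈G : y ∈H G
          y∈G with w∈G
          ... | _ , i , i∈K , w-b≤wi-bi with ⊕-sel (y i) (z i)
          ...   | inj₁ wi≡yi = y-NonZero , i , i∈K , λ j j∉ →
                    ≤ₘ-trans (y-b≤w-b j) (subst (λ v → _ ≤ₘ v −ᵣ b i) wi≡yi (w-b≤wi-bi j j∉))
          ...   | inj₂ wi≡zi = ≤s⇒y∈G λ j j∉ →
                    ≤ₘ-trans (y-b≤w-b j) (subst (_ ≤ₘ_)
                      (trans (cong (_−ᵣ b i) wi≡zi) (cong fin ([x+y]-x≡y (b i) s)))
                      (w-b≤wi-bi j j∉))

        x∈H : x ∈H H
        x∈H with ∈H-dominated H (⋂Γ₂⊆H y y∈G) m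
        ... | i , i∈I , ym-am≤yi-ai with ⊕-sel (x i) (fin (a i + t))
        ...   | inj₁ yi≡xi = ∈H-intro H (m , fin≤ₘ⇒≢-∞ ρ≤xm-am ∘ cong (_−ᵣ a m)) i∈I λ k →
                  ≤ₘ-trans (x-a≤ρ k)
                           (≤ₘ-trans ρ≤ym-am (subst (λ v → _ ≤ₘ v −ᵣ a i) yi≡xi ym-am≤yi-ai))
        ...   | inj₂ yi≡a+t = ⊥-elim (<⇒≱ (x-ε<x ρ 0<ε) (fin≤⁻ (subst (fin ρ ≤ₘ_)
                  (trans (cong (_−ᵣ a i) yi≡a+t) (cong fin ([x+y]-x≡y (a i) t)))
                  (≤ₘ-trans ρ≤ym-am ym-am≤yi-ai))))

      ⋂Γ₁⊆H : ∀ x → NonZero x → x ∈⋂ Γ₁ → x ∈H H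
      ⋂Γ₁⊆H x (j , xj≢-∞) x∈⋂Γ₁ with argmax-Fin ≤ₘ-totalOrder (λ k → x k −ᵣ a k) k₀
      ... | m , x-a≤xm-am with -∞-or-fin (x m −ᵣ a m)
      ...   | inj₁ xm-am≡-∞ =
        ⊥-elim (xj≢-∞ (−ᵣ≤ₘ-∞⇒≡-∞ (subst (x j −ᵣ a j ≤ₘ_) xm-am≡-∞ (x-a≤xm-am j))))
      ...   | inj₂ (ρ , xm-am≡ρ) = Lift.x∈H x x∈⋂Γ₁ ρ m
                (λ k → subst (x k −ᵣ a k ≤ₘ_) xm-am≡ρ (x-a≤xm-am k))
                (subst (_≤ₘ x m −ᵣ a m) xm-am≡ρ ≤ₘ-refl)

    ⋂Γ₁⊆H : ∀ x → NonZero x → x ∈⋂ Γ₁ → x ∈H H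
    ⋂Γ₁⊆H = let ε , 0<ε , ε<spread = ∃-positive-below Γ₂ spread 0<spread
            in Margin.⋂Γ₁⊆H ε 0<ε ε<spread

corollary3 : (R : Reals) → let open Trop R in
    {n : ℕ} (C : Cone n) (Γ₁ Γ₂ : List (HalfSpace n)) (H : HalfSpace n) →
    InΣ C Γ₁ → InΣ C Γ₂ → Σ𝓗 C H →
    (∀ G → G ∈L Γ₂ → ¬ (apex H ≈ℙ apex G)) →
    (∀ H′ → (τ C (H ∷ Γ₁) H′ → τ C Γ₂ H′) × (τ C Γ₂ H′ → τ C (H ∷ Γ₁) H′)) →
    τ C Γ₁ H
corollary3 R C Γ₁ Γ₂ H Γ₁⊆Σ Γ₂⊆Σ H∈Σ apexes-distinct τ[H∷Γ₁]≡τΓ₂ =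
  τ-intro C Γ₁ H H∈Σ (⋂Γ₁⊆H Γ₁ Γ₂ H
    (apex∈⋂ C H Γ₁ H∈Σ Γ₁⊆Σ)
    (λ G G∈ → apex∈H C G H (Γ₂⊆Σ G G∈) H∈Σ)
    (λ G G∈ → apex∈⋂ C G Γ₁ (Γ₂⊆Σ G G∈) Γ₁⊆Σ)
    apexes-distinct
    (λ G G∈ → τ-elim C (H ∷ Γ₁) G (proj₂ (τ[H∷Γ₁]≡τΓ₂ G) (τ-refl C Γ₂ G G∈ (Γ₂⊆Σ G G∈))))
    (τ-elim C Γ₂ H (proj₁ (τ[H∷Γ₁]≡τΓ₂ H) (τ-refl C (H ∷ Γ₁) H (here refl) H∈Σ))))
  where
  open Trop R
  open HalfSpaces R
  open Redundancy R
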